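{- Let $G$ be a finite simple undirected graph with no antitriangle that has a Kempe-coloring of size $k$. Then $G$ is $k$-connected or $G$ admits a shallow clique minor of size $k$.
   Context: An anticlique of $G$ is a set of pairwise nonadjacent vertices; an antitriangle is an anticlique of size $3$. A coloring of $G$ is a partition of $V(G)$ into (nonempty) anticliques; its size is the number of classes. A coloring $\mathfrak{C}$ of $G$ is a Kempe-coloring if for any two distinct members $A,B \in \mathfrak{C}$ the induced subgraph $G[A \cup B]$ is connected. A subset of $V(G)$ is connected if it induces a connected subgraph; two subsets of $V(G)$ are adjacent if some edge of $G$ has one end in each. A clique minor of $G$ is a set of pairwise disjoint, pairwise adjacent, connected, nonempty subsets of $V(G)$; it is shallow if all its members have size $1$ or $2$. -}

module Defs where

open import Data.Nat using (ℕ; _<_; suc)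
open import Data.Fin using (Fin)
open import Data.Fin.Subset using (Subset; _∈_; _∉_; ∣_∣)
open import Data.Product using (Σ; ∃; _×_; _,_)
open import Data.Sum using (_⊎_)
open import Relation.Binary.PropositionalEquality using (_≡_; _≢_)
open import Relation.Nullary using (¬_; Dec)

record Graph (n : ℕ) : Set₁ where
  field
    Adj    : Fin n → Fin n → Set
    adj?   : ∀ u v → Dec (Adj u v)
    sym    : ∀ {u v} → Adj u v → Adj v u
    irrefl : ∀ {u} → ¬ Adj u u

module _ {n : ℕ} (G : Graph n) where
  open Graph G

  data WalkIn (S : Fin n → Set) : Fin n → Fin n → Set where
    here : ∀ {u} → S u → WalkIn S u u
    step : ∀ {u w v} → S u → Adj u w → WalkIn S w v → WalkIn S u v

  ConnectedSet : (Fin n → Set) → Set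
  ConnectedSet S = ∀ u v → S u → S v → WalkIn S u v

  NoAntitriangle : Set
  NoAntitriangle = ∀ u v w → u ≢ v → v ≢ w → u ≢ w →
    ¬ (¬ Adj u v × ¬ Adj v w × ¬ Adj u w)

  -- A coloring of size k: partition of V(G) into k nonempty anticliques,
  -- encoded by the class map c : V(G) → Fin k (surjective = classes nonempty).
  record Coloring (k : ℕ) : Set where
    field
      col        : Fin n → Fin k
      surjective : ∀ i → ∃ λ v → col v ≡ i
      anticlique : ∀ u v → col u ≡ col v → ¬ Adj u v

  IsKempe : ∀ {k} → Coloring k → Set
  IsKempe {k} C = ∀ (i j : Fin k) → i ≢ j →
    ConnectedSet (λ v → col v ≡ i ⊎ col v ≡ j)
    where open Coloring C

  KConnected : ℕ → Set
  KConnected k = k < n × (∀ (X : Subset n) → ∣ X ∣ < k → ConnectedSet (λ v → v ∉ X))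

  record ShallowCliqueMinor (k : ℕ) : Set where
    field
      bag       : Fin k → Subset n
      nonempty  : ∀ i → ∃ λ v → v ∈ bag i
      shallow   : ∀ i → ∣ bag i ∣ ≡ 1 ⊎ ∣ bag i ∣ ≡ 2
      connected : ∀ i → ConnectedSet (λ v → v ∈ bag i)
      disjoint  : ∀ i j → i ≢ j → ∀ v → v ∈ bag i → v ∉ bag j
      adjacent  : ∀ i j → i ≢ j → ∃ λ u → ∃ λ v → u ∈ bag i × v ∈ bag j × Adj u v

-- Each class is an anticlique, so it has one or two vertices (no antitriangle),
-- and every vertex has a neighbour in every other class (Kempe chains).  If
-- n ≤ k, all classes are single vertices and form a clique.  Otherwise take X
-- with |X| < k.  Some class {a} or {a, a′} misses X and is dominating, so G - X
-- is connected unless a, a′ are joined by no path of length ≤ 3 in G - X.  Then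
-- a, a′ have a common neighbour m j in every other class j, all lying in X; the
-- remaining vertices b j of the other classes are adjacent to exactly one of a,
-- a′, giving two cliques that are fully joined to the m's across (`square`).
-- Taking the side with more b's, say a's side, the bags {a}, {m j} for one-vertex
-- classes, {b j} on a's side and {m j, m (π j)}, where π matches the other side
-- into a's side, form the minor (`HubMinor`).

module Submission where

open import Defs
open import Data.Nat using (ℕ)
open import Data.Product using (Σ)
open import Data.Sum using (_⊎_)

open import Data.Nat as ℕ using (zero; suc; _≤_; _<_; z≤n; s≤s)
import Data.Nat.Properties as ℕP
open import Data.Fin using (Fin; zero; suc; _≟_; inject≤)
import Data.Fin.Properties as FP
open import Data.Fin.Subset using (Subset; _∈_; _∉_; ∣_∣; ⁅_⁆; _∪_; _-_; inside; outside)
import Data.Fin.Subset.Properties as SP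
open import Data.Vec using ([]; _∷_)
open import Data.Product using (∃; ∃₂; _×_; _,_; proj₁; proj₂)
open import Data.Sum using (inj₁; inj₂)
open import Data.Empty using (⊥-elim)
open import Data.List using (List; length; lookup; filter; allFin)
open import Data.List.Relation.Unary.All as All using ()
open import Data.List.Relation.Unary.All.Properties using (all-filter)
open import Data.List.Relation.Unary.AllPairs using (AllPairs; _∷_)
open import Data.List.Relation.Unary.Any using (index)
open import Data.List.Membership.Propositional using () renaming (_∈_ to _∈ˡ_)
open import Data.List.Membership.Propositional.Properties using (∈-lookup; ∈-filter⁺; ∈-allFin)
import Data.List.Membership.Setoid.Properties as SetoidMembership
open import Data.List.Relation.Unary.Unique.Propositional.Properties using (allFin⁺; filter⁺)
open import Function.Definitions using (Injective)
open import Relation.Unary using (Decidable)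
open import Relation.Binary.PropositionalEquality as Eq using (_≡_; _≢_; refl; cong; subst)
open import Relation.Nullary using (¬_; Dec; yes; no; ¬?)
open import Relation.Nullary.Decidable using (_×-dec_; _⊎-dec_; decidable-stable)

allSubsets-or : ∀ {n} {P : Subset n → Set} {B : Set} →
                (∀ X → P X ⊎ B) → (∀ X → P X) ⊎ B
allSubsets-or {zero} h with h []
... | inj₁ p = inj₁ λ { [] → p }
... | inj₂ b = inj₂ b
allSubsets-or {suc n} {P} h
  with allSubsets-or {P = λ X → P (inside ∷ X)} (λ X → h (inside ∷ X))
     | allSubsets-or {P = λ X → P (outside ∷ X)} (λ X → h (outside ∷ X))
... | inj₂ b | _      = inj₂ b
... | inj₁ _ | inj₂ b = inj₂ b
... | inj₁ pin | inj₁ pout = inj₁ λ { (inside ∷ X) → pin X ; (outside ∷ X) → pout X }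

injection⇒≤∣∣ : ∀ {m n} (X : Subset n) (f : Fin m → Fin n) →
                Injective _≡_ _≡_ f → (∀ i → f i ∈ X) → m ≤ ∣ X ∣
injection⇒≤∣∣ {zero}  X f inj inX = z≤n
injection⇒≤∣∣ {suc m} X f inj inX =
  ℕP.≤-trans (s≤s rest) (SP.x∈p⇒∣p-x∣<∣p∣ (inX zero))
  where
  rest : m ≤ ∣ X - f zero ∣
  rest = injection⇒≤∣∣ (X - f zero) (λ i → f (suc i))
           (λ e → FP.suc-injective (inj e))
           (λ i → SP.x∈p∧x≢y⇒x∈p-y (inX (suc i)) (λ e → FP.0≢1+n (Eq.sym (inj e))))

∣⁅x⁆∪⁅y⁆∣≡2 : ∀ {n} (x y : Fin n) → x ≢ y → ∣ ⁅ x ⁆ ∪ ⁅ y ⁆ ∣ ≡ 2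
∣⁅x⁆∪⁅y⁆∣≡2 zero zero x≢y = ⊥-elim (x≢y refl)
∣⁅x⁆∪⁅y⁆∣≡2 zero (suc y) _ rewrite SP.∪-identityˡ ⁅ y ⁆ = cong suc (SP.∣⁅x⁆∣≡1 y)
∣⁅x⁆∪⁅y⁆∣≡2 (suc x) zero _ rewrite SP.∪-identityʳ ⁅ x ⁆ = cong suc (SP.∣⁅x⁆∣≡1 x)
∣⁅x⁆∪⁅y⁆∣≡2 (suc x) (suc y) x≢y = ∣⁅x⁆∪⁅y⁆∣≡2 x y (λ e → x≢y (cong suc e))

lookup-injective : ∀ {A : Set} {xs : List A} → AllPairs _≢_ xs →
                   ∀ {i j} → lookup xs i ≡ lookup xs j → i ≡ j
lookup-injective (_ ∷ _)    {zero}  {zero}  _ = refl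
lookup-injective (x≢ ∷ _)   {zero}  {suc j} e = ⊥-elim (All.lookup x≢ (∈-lookup j) e)
lookup-injective (x≢ ∷ _)   {suc i} {zero}  e = ⊥-elim (All.lookup x≢ (∈-lookup i) (Eq.sym e))
lookup-injective (_ ∷ uniq) {suc i} {suc j} e = cong suc (lookup-injective uniq e)

count : ∀ {k} {P : Fin k → Set} → Decidable P → ℕ
count {k} P? = length (filter P? (allFin k))

record Embedding {k} (Q P : Fin k → Set) : Set where
  field
    image       : ∀ {j} → Q j → Fin k
    image∈P     : ∀ {j} (q : Q j) → P (image q)
    injective   : ∀ {i j} (q : Q i) (q′ : Q j) → image q ≡ image q′ → i ≡ j

-- If Q has at most as many elements as P, then Q embeds into P:
-- send the t-th element of Q to the t-th element of P.
embedding : ∀ {k} {P Q : Fin k → Set} (P? : Decidable P) (Q? : Decidable Q) →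
            count Q? ≤ count P? → Embedding Q P
embedding {k} {P} {Q} P? Q? Q≤P = record
  { image     = image
  ; image∈P   = λ q → All.lookup (all-filter P? (allFin k)) (∈-lookup (position q))
  ; injective = λ q q′ e →
      SetoidMembership.index-injective (Eq.setoid (Fin k)) (member q) (member q′)
        (FP.inject≤-injective Q≤P Q≤P _ _
          (lookup-injective (filter⁺ P? (allFin⁺ k)) e))
  }
  where
  member : ∀ {j} → Q j → j ∈ˡ filter Q? (allFin k)
  member q = ∈-filter⁺ Q? (∈-allFin _) q
  position : ∀ {j} → Q j → Fin (count P?)
  position q = inject≤ (index (member q)) Q≤P
  image : ∀ {j} → Q j → Fin k
  image q = lookup (filter P? (allFin k)) (position q)

module Walks {n : ℕ} (G : Graph n) where
  open Graph G

  start : ∀ {S u v} → WalkIn G S u v → S u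
  start (here s)     = s
  start (step s _ _) = s

  _++ʷ_ : ∀ {S u v w} → WalkIn G S u v → WalkIn G S v w → WalkIn G S u w
  here _     ++ʷ q = q
  step s a p ++ʷ q = step s a (p ++ʷ q)

  reverseʷ : ∀ {S u v} → WalkIn G S u v → WalkIn G S v u
  reverseʷ (here s)     = here s
  reverseʷ (step s a p) = reverseʷ p ++ʷ step (start p) (sym a) (here s)

  widen : ∀ {S T : Fin n → Set} → (∀ {x} → S x → T x) →
          ∀ {u v} → WalkIn G S u v → WalkIn G T u v
  widen S⊆T (here s)     = here (S⊆T s)
  widen S⊆T (step s a p) = step (S⊆T s) a (widen S⊆T p)

  firstStep : ∀ {S u v} → WalkIn G S u v → u ≢ v → ∃ λ z → S z × Adj u z
  firstStep (here _)     u≢v = ⊥-elim (u≢v refl)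
  firstStep (step _ a p) _   = _ , start p , a

  exit : ∀ {S U : Fin n → Set} {u v} → (∀ x → Dec (U x)) →
         WalkIn G S u v → U u → ¬ U v →
         ∃₂ λ x y → S y × U x × ¬ U y × Adj x y
  exit U? (here _) Uu ¬Uv = ⊥-elim (¬Uv Uu)
  exit U? (step {w = w} _ a p) Uu ¬Uv with U? w
  ... | yes Uw = exit U? p Uw ¬Uv
  ... | no ¬Uw = _ , w , start p , Uu , ¬Uw , a

  hub⇒connected : ∀ {S} (c : Fin n) → (∀ u → S u → WalkIn G S u c) → ConnectedSet G S
  hub⇒connected c toHub u v Su Sv = toHub u Su ++ʷ reverseʷ (toHub v Sv)

module Bags {n : ℕ} (G : Graph n) where
  open Graph G
  open Walks G using (widen)

  data Bag : Set where
    one : Fin n → Bag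
    two : (u w : Fin n) → Adj u w → Bag

  _∈ᵇ_ : Fin n → Bag → Set
  v ∈ᵇ one x     = v ≡ x
  v ∈ᵇ two u w _ = v ≡ u ⊎ v ≡ w

  Edge : Bag → Bag → Set
  Edge B C = ∃₂ λ u v → u ∈ᵇ B × v ∈ᵇ C × Adj u v

  flipEdge : ∀ {B C} → Edge B C → Edge C B
  flipEdge (u , v , u∈B , v∈C , a) = v , u , v∈C , u∈B , sym a

  record Touching (B C : Bag) : Set where
    field
      disjoint : ∀ {v} → v ∈ᵇ B → ¬ v ∈ᵇ C
      edge     : Edge B C

  toSubset : Bag → Subset n
  toSubset (one x)     = ⁅ x ⁆
  toSubset (two u w _) = ⁅ u ⁆ ∪ ⁅ w ⁆

  fromSubset : ∀ B {v} → v ∈ toSubset B → v ∈ᵇ B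
  fromSubset (one x) v∈ = SP.x∈⁅y⁆⇒x≡y x v∈
  fromSubset (two u w _) v∈ with SP.x∈p∪q⁻ ⁅ u ⁆ ⁅ w ⁆ v∈
  ... | inj₁ v∈u = inj₁ (SP.x∈⁅y⁆⇒x≡y u v∈u)
  ... | inj₂ v∈w = inj₂ (SP.x∈⁅y⁆⇒x≡y w v∈w)

  toSubset⁺ : ∀ B {v} → v ∈ᵇ B → v ∈ toSubset B
  toSubset⁺ (one x)     refl        = SP.x∈⁅x⁆ x
  toSubset⁺ (two u w _) (inj₁ refl) = SP.x∈p∪q⁺ (inj₁ (SP.x∈⁅x⁆ u))
  toSubset⁺ (two u w _) (inj₂ refl) = SP.x∈p∪q⁺ {p = ⁅ u ⁆} (inj₂ (SP.x∈⁅x⁆ w))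

  bag-connected : ∀ B → ConnectedSet G (λ v → v ∈ᵇ B)
  bag-connected (one x) .x .x refl refl = here refl
  bag-connected (two u w a) .u .u (inj₁ refl) (inj₁ refl) = here (inj₁ refl)
  bag-connected (two u w a) .w .w (inj₂ refl) (inj₂ refl) = here (inj₂ refl)
  bag-connected (two u w a) .u .w (inj₁ refl) (inj₂ refl) =
    step (inj₁ refl) a (here (inj₂ refl))
  bag-connected (two u w a) .w .u (inj₂ refl) (inj₁ refl) =
    step (inj₂ refl) (sym a) (here (inj₁ refl))

  cliqueMinor : ∀ {k} (bag : Fin k → Bag) →
                (∀ i j → i ≢ j → Touching (bag i) (bag j)) → ShallowCliqueMinor G k
  cliqueMinor bag touch = record
    { bag       = λ i → toSubset (bag i)
    ; nonempty  = λ i → nonempty (bag i)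
    ; shallow   = λ i → shallow (bag i)
    ; connected = λ i u v u∈ v∈ →
        widen (toSubset⁺ (bag i)) (bag-connected (bag i) u v (fromSubset _ u∈) (fromSubset _ v∈))
    ; disjoint  = λ i j i≢j v v∈i v∈j →
        Touching.disjoint (touch i j i≢j) (fromSubset _ v∈i) (fromSubset _ v∈j)
    ; adjacent  = λ i j i≢j → let (u , v , u∈ , v∈ , a) = Touching.edge (touch i j i≢j)
                              in u , v , toSubset⁺ (bag i) u∈ , toSubset⁺ (bag j) v∈ , a
    }
    where
    nonempty : ∀ B → ∃ λ v → v ∈ toSubset B
    nonempty (one x)       = x , toSubset⁺ (one x) refl
    nonempty B@(two u _ _) = u , toSubset⁺ B (inj₁ refl)
    shallow : ∀ B → ∣ toSubset B ∣ ≡ 1 ⊎ ∣ toSubset B ∣ ≡ 2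
    shallow (one x)     = inj₁ (SP.∣⁅x⁆∣≡1 x)
    shallow (two u w a) = inj₂ (∣⁅x⁆∪⁅y⁆∣≡2 u w (λ { refl → irrefl a }))

module KempeColoring {n : ℕ} (G : Graph n) (noAntitriangle : NoAntitriangle G)
                     {k : ℕ} (C : Coloring G k) (kempe : IsKempe G C) where
  open Graph G
  open Coloring C
  open Walks G
  open Bags G

  Twins : Fin n → Fin n → Set
  Twins x y = col x ≡ col y × x ≢ y

  ≡⇒sameClass : ∀ {u v i j} → col u ≡ i → col v ≡ j → u ≡ v → i ≡ j
  ≡⇒sameClass cu cv u≡v = Eq.trans (Eq.sym cu) (Eq.trans (cong col u≡v) cv)

  differentClass⇒≢ : ∀ {u v i j} → col u ≡ i → col v ≡ j → i ≢ j → u ≢ v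
  differentClass⇒≢ cu cv i≢j u≡v = i≢j (≡⇒sameClass cu cv u≡v)

  -- Kempe chains: every vertex has a neighbour in every other class.
  neighbourIn : ∀ u j → col u ≢ j → ∃ λ w → col w ≡ j × Adj u w
  neighbourIn u j cu≢j with surjective j
  ... | w₀ , cw₀ with firstStep (kempe (col u) j cu≢j u w₀ (inj₁ refl) (inj₂ cw₀))
                               (λ { refl → cu≢j cw₀ })
  ...   | z , inj₁ cz , a = ⊥-elim (anticlique u z (Eq.sym cz) a)
  ...   | z , inj₂ cz , a = z , cz , a

  -- No antitriangle: a class (an anticlique) has at most two vertices.
  atMostTwo : ∀ {u v w} → col u ≡ col v → col v ≡ col w → u ≡ v ⊎ v ≡ w ⊎ u ≡ w
  atMostTwo {u} {v} {w} cuv cvw with u ≟ v | v ≟ w | u ≟ w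
  ... | yes u≡v | _       | _       = inj₁ u≡v
  ... | no _    | yes v≡w | _       = inj₂ (inj₁ v≡w)
  ... | no _    | no _    | yes u≡w = inj₂ (inj₂ u≡w)
  ... | no u≢v  | no v≢w  | no u≢w  = ⊥-elim (noAntitriangle u v w u≢v v≢w u≢w
      (anticlique u v cuv , anticlique v w cvw , anticlique u w (Eq.trans cuv cvw)))

  twins-cover : ∀ {x y v} → Twins x y → col v ≡ col x → v ≡ x ⊎ v ≡ y
  twins-cover {x} {y} (cxy , x≢y) cvx with atMostTwo cvx cxy
  ... | inj₁ v≡x        = inj₁ v≡x
  ... | inj₂ (inj₁ x≡y) = ⊥-elim (x≢y x≡y)
  ... | inj₂ (inj₂ v≡y) = inj₂ v≡y

  commonNonNeighbour : ∀ {x y z} → x ≢ y → x ≢ z → y ≢ z →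
                       ¬ Adj x z → ¬ Adj y z → Adj x y
  commonNonNeighbour {x} {y} {z} x≢y x≢z y≢z x≁z y≁z with adj? x y
  ... | yes x∼y = x∼y
  ... | no x≁y = ⊥-elim (noAntitriangle x z y x≢z (λ e → y≢z (Eq.sym e)) x≢y
                           (x≁z , (λ a → y≁z (sym a)) , x≁y))

  -- The partner of x: the other vertex of its class if there is one, else x itself.
  private
    Mate : Fin n → Fin n → Set
    Mate x v = col v ≡ col x × v ≢ x

    mate? : ∀ x → Dec (∃ (Mate x))
    mate? x = FP.any? λ v → (col v ≟ col x) ×-dec ¬? (v ≟ x)

    pick : ∀ {x} → Dec (∃ (Mate x)) → Fin n
    pick     (yes (v , _)) = v
    pick {x} (no _)        = x

    pick-spec : ∀ {x} (d : Dec (∃ (Mate x))) →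
                col (pick d) ≡ col x × (pick d ≡ x → ∀ v → col v ≡ col x → v ≡ x)
    pick-spec     (yes (v , cv , v≢x)) = cv , λ v≡x → ⊥-elim (v≢x v≡x)
    pick-spec {x} (no ¬mate)           = refl , λ _ v cv → lonely v cv
      where
      lonely : ∀ v → col v ≡ col x → v ≡ x
      lonely v cv with v ≟ x
      ... | yes v≡x = v≡x
      ... | no v≢x  = ⊥-elim (¬mate (v , cv , v≢x))

  partner : Fin n → Fin n
  partner x = pick (mate? x)

  partner-col : ∀ x → col (partner x) ≡ col x
  partner-col x = proj₁ (pick-spec (mate? x))

  partner-alone : ∀ x → partner x ≡ x → ∀ v → col v ≡ col x → v ≡ x
  partner-alone x = proj₂ (pick-spec (mate? x))

  partner-twins : ∀ x → partner x ≢ x → Twins x (partner x)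
  partner-twins x p≢x = Eq.sym (partner-col x) , λ e → p≢x (Eq.sym e)

  alone-universal : ∀ y → partner y ≡ y → ∀ x → col x ≢ col y → Adj y x
  alone-universal y alone x cx≢cy with neighbourIn x (col y) cx≢cy
  ... | w , cw , x∼w = sym (subst (Adj x) (partner-alone y alone w cw) x∼w)

  -- Two two-vertex classes {x, x′}, {y, y′} with x ≁ y: all other three
  -- cross pairs are edges, since the Kempe chain on the two classes is connected.
  square : ∀ {x x′ y y′} → Twins x x′ → Twins y y′ → col x ≢ col y → ¬ Adj x y →
           Adj x y′ × Adj x′ y × Adj x′ y′
  square {x} {x′} {y} {y′} txx′@(cxx′ , x≢x′) tyy′@(cyy′ , y≢y′) cx≢cy x≁y =
    x∼y′ , x′∼y , x′∼y′
    where
    x∼y′ : Adj x y′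
    x∼y′ with neighbourIn x (col y) cx≢cy
    ... | w , cw , x∼w with twins-cover tyy′ cw
    ...   | inj₁ refl = ⊥-elim (x≁y x∼w)
    ...   | inj₂ refl = x∼w

    x′∼y : Adj x′ y
    x′∼y with neighbourIn y (col x) (λ e → cx≢cy (Eq.sym e))
    ... | w , cw , y∼w with twins-cover txx′ cw
    ...   | inj₁ refl = ⊥-elim (x≁y (sym y∼w))
    ...   | inj₂ refl = sym y∼w

    -- leave U = {x, y′} along the chain from x to x′; the only possible edge is y′x′
    U : Fin n → Set
    U v = v ≡ x ⊎ v ≡ y′

    x′∉U : ¬ U x′
    x′∉U (inj₁ x′≡x) = x≢x′ (Eq.sym x′≡x)
    x′∉U (inj₂ refl) = cx≢cy (Eq.trans cxx′ (Eq.sym cyy′))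

    x′∼y′ : Adj x′ y′
    x′∼y′ with exit (λ v → (v ≟ x) ⊎-dec (v ≟ y′))
                    (kempe (col x) (col y) cx≢cy x x′ (inj₁ refl) (inj₁ (Eq.sym cxx′)))
                    (inj₁ refl) x′∉U
    ... | p , q , cq , p∈U , q∉U , p∼q with p∈U | cq
    ...   | inj₁ refl | inj₁ cq′ = ⊥-elim (anticlique q p cq′ (sym p∼q))
    ...   | inj₂ refl | inj₂ cq′ = ⊥-elim (anticlique q p (Eq.trans cq′ cyy′) (sym p∼q))
    ...   | inj₁ refl | inj₂ cq′ with twins-cover tyy′ cq′
    ...     | inj₁ refl = ⊥-elim (x≁y p∼q)
    ...     | inj₂ refl = ⊥-elim (q∉U (inj₂ refl))
    x′∼y′ | p , q , _ , _ , q∉U , p∼q | inj₂ refl | inj₁ cq′ with twins-cover txx′ cq′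
    ...     | inj₁ refl = ⊥-elim (q∉U (inj₁ refl))
    ...     | inj₂ refl = sym p∼q


  twins-commonNeighbour : ∀ {x x′} → Twins x x′ → ∀ w → col w ≢ col x →
                          ∃ λ z → col z ≡ col w × Adj x z × Adj x′ z
  twins-commonNeighbour {x} {x′} txx′@(cxx′ , x≢x′) w cw≢cx with partner w ≟ w
  ... | yes alone = w , refl , sym (alone-universal w alone x (λ e → cw≢cx (Eq.sym e))) ,
                    sym (alone-universal w alone x′ cx′≢cw)
    where
    cx′≢cw : col x′ ≢ col w
    cx′≢cw e = cw≢cx (Eq.trans (Eq.sym e) (Eq.sym cxx′))
  ... | no w′≢w with adj? x w | adj? x′ w
  ...   | yes x∼w | yes x′∼w = w , refl , x∼w , x′∼w
  ...   | yes _   | no x′≁w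
          with square (Eq.sym cxx′ , λ e → x≢x′ (Eq.sym e)) (partner-twins w w′≢w)
                      (λ e → cw≢cx (Eq.trans (Eq.sym e) (Eq.sym cxx′))) x′≁w
  ...     | x′∼w′ , _ , x∼w′ = partner w , partner-col w , x∼w′ , x′∼w′
  twins-commonNeighbour txx′ w cw≢cx | no w′≢w | no x≁w | _
          with square txx′ (partner-twins w w′≢w) (λ e → cw≢cx (Eq.sym e)) x≁w
  ...     | x∼w′ , _ , x′∼w′ = partner w , partner-col w , x∼w′ , x′∼w′

  rep : Fin k → Fin n
  rep i = proj₁ (surjective i)

  rep-col : ∀ i → col (rep i) ≡ i
  rep-col i = proj₂ (surjective i)

  rep-injective : ∀ {i j} → rep i ≡ rep j → i ≡ j
  rep-injective = ≡⇒sameClass (rep-col _) (rep-col _)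

  allAlone : ¬ (k < n) → ∀ v → v ≡ rep (col v)
  allAlone k≮n v with v ≟ rep (col v)
  ... | yes v≡rep = v≡rep
  ... | no v≢rep  = ⊥-elim (k≮n (FP.injective⇒≤ {f = f} f-injective))
    where
    -- v together with all the chosen vertices: k + 1 distinct vertices
    f : Fin (suc k) → Fin n
    f zero    = v
    f (suc i) = rep i

    v≢rep′ : ∀ j → v ≢ rep j
    v≢rep′ j e = v≢rep (Eq.trans e (cong rep (Eq.sym (Eq.trans (cong col e) (rep-col j)))))

    f-injective : ∀ {x y} → f x ≡ f y → x ≡ y
    f-injective {zero}  {zero}  _ = refl
    f-injective {zero}  {suc j} e = ⊥-elim (v≢rep′ j e)
    f-injective {suc i} {zero}  e = ⊥-elim (v≢rep′ i (Eq.sym e))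
    f-injective {suc i} {suc j} e = cong suc (rep-injective e)

  singletonMinor : (∀ v → v ≡ rep (col v)) → ShallowCliqueMinor G k
  singletonMinor alone = cliqueMinor (λ i → one (rep i)) λ i j i≢j → record
    { disjoint = λ { refl e → i≢j (rep-injective e) }
    ; edge     = edge i j i≢j
    }
    where
    edge : ∀ i j → i ≢ j → Edge (one (rep i)) (one (rep j))
    edge i j i≢j with neighbourIn (rep i) j (λ e → i≢j (Eq.trans (Eq.sym (rep-col i)) e))
    ... | w , cw , a = rep i , rep j , refl , refl ,
                       subst (Adj (rep i)) (Eq.trans (alone w) (cong rep cw)) a

  -- A vertex m j of every class j, with a distinguished class i₀; b j is the
  -- partner of m j, so class j is {m j} or {m j, b j}.
  module Skeleton (i₀ : Fin k) (m : Fin k → Fin n) (m-col : ∀ j → col (m j) ≡ j) where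

    b : Fin k → Fin n
    b j = partner (m j)

    b-col : ∀ j → col (b j) ≡ j
    b-col j = Eq.trans (partner-col (m j)) (m-col j)

    m-injective : ∀ {i j} → m i ≡ m j → i ≡ j
    m-injective = ≡⇒sameClass (m-col _) (m-col _)

    Twin : Fin k → Set
    Twin j = j ≢ i₀ × b j ≢ m j

    twin? : ∀ j → Dec (Twin j)
    twin? j = ¬? (j ≟ i₀) ×-dec ¬? (b j ≟ m j)

    twin-pair : ∀ {j} → Twin j → Twins (b j) (m j)
    twin-pair {j} (_ , b≢m) = partner-col (m j) , b≢m

    joined : ∀ {i j} → Twin i → Twin j → i ≢ j → ¬ Adj (b i) (b j) →
             Adj (b i) (m j) × Adj (m i) (m j)
    joined {i} {j} ti tj i≢j bi≁bj
      with square (twin-pair ti) (twin-pair tj)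
                  (λ e → i≢j (Eq.trans (Eq.sym (b-col i)) (Eq.trans e (b-col j)))) bi≁bj
    ... | bi∼mj , _ , mi∼mj = bi∼mj , mi∼mj

    -- The twin classes
    -- split into P (b j ∼ h) and Q; P is a clique with no edges to the b-vertices
    -- of Q, and Q embeds into P.  Bags: {h}; {m j} for single-vertex classes;
    -- {b j} for j ∈ P; and {m j, m (π j)} for j ∈ Q.
    module HubMinor (h : Fin n) (h-col : col h ≡ i₀) (h-m : ∀ j → j ≢ i₀ → Adj h (m j))
                    {P Q : Fin k → Set} (P? : Decidable P)
                    (P-twin : ∀ {j} → P j → Twin j) (P-h : ∀ {j} → P j → Adj h (b j))
                    (Q-twin : ∀ {j} → Q j → Twin j)
                    (P-or-Q : ∀ {j} → Twin j → ¬ P j → Q j)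
                    (P-clique : ∀ {i l} → P i → P l → i ≢ l → Adj (b i) (b l))
                    (P-Q-apart : ∀ {i j} → P i → Q j → ¬ Adj (b i) (b j))
                    (π : Embedding Q P) where
      open Embedding π

      cross : ∀ {i j} → P i → Q j → i ≢ j → Adj (b i) (m j) × Adj (m i) (m j)
      cross p q i≢j = joined (P-twin p) (Q-twin q) i≢j (P-Q-apart p q)

      data Role (j : Fin k) : Set where
        hub  : j ≡ i₀ → Role j
        solo : j ≢ i₀ → b j ≡ m j → Role j
        near : P j → Role j
        far  : (q : Q j) → ¬ P j → Role j

      role : ∀ j → Role j
      role j with j ≟ i₀ | b j ≟ m j | P? j
      ... | yes j≡i₀ | _       | _     = hub j≡i₀
      ... | no j≢i₀  | yes b≡m | _     = solo j≢i₀ b≡m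
      ... | no _     | no _    | yes p = near p
      ... | no j≢i₀  | no b≢m  | no ¬p = far (P-or-Q (j≢i₀ , b≢m) ¬p) ¬p

      image≢ : ∀ {i j} (q : Q j) → ¬ P i → image q ≢ i
      image≢ q ¬p e = ¬p (subst P e (image∈P q))

      bag : ∀ {j} → Role j → Bag
      bag     (hub _)    = one h
      bag {j} (solo _ _) = one (m j)
      bag {j} (near _)   = one (b j)
      bag {j} (far q ¬p) =
        two (m j) (m (image q)) (sym (proj₂ (cross (image∈P q) q (image≢ q ¬p))))

      -- Every vertex of a bag has the bag's colour, except the vertex borrowed
      -- by a Q-bag from the class of its partner in P.
      member : ∀ {j v} (r : Role j) → v ∈ᵇ bag r →
               (col v ≡ j × (P j → v ≡ b j)) ⊎ (Σ (Q j) λ q → v ≡ m (image q))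
      member (hub j≡i₀)    refl = inj₁ (Eq.trans h-col (Eq.sym j≡i₀) ,
                                        λ p → ⊥-elim (proj₁ (P-twin p) j≡i₀))
      member (solo _ b≡m)  refl = inj₁ (m-col _ , λ p → ⊥-elim (proj₂ (P-twin p) b≡m))
      member (near _)      refl = inj₁ (b-col _ , λ _ → refl)
      member (far _ ¬p) (inj₁ refl) = inj₁ (m-col _ , λ p → ⊥-elim (¬p p))
      member (far q _)  (inj₂ refl) = inj₂ (q , refl)

      -- the borrowed vertex m (π j) is not in the bag {b (π j)} of its own class
      borrowed : ∀ {i j v} → col v ≡ i → (P i → v ≡ b i) → (q : Q j) → ¬ v ≡ m (image q)
      borrowed {i} cv own q refl =
        proj₂ (P-twin pᵢ) (Eq.sym (Eq.trans (cong m (Eq.sym e)) (own pᵢ)))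
        where
        e : image q ≡ i
        e = Eq.trans (Eq.sym (m-col (image q))) cv
        pᵢ : P i
        pᵢ = subst P e (image∈P q)

      disjoint : ∀ {i j} → i ≢ j → (r : Role i) (r′ : Role j) →
                 ∀ {v} → v ∈ᵇ bag r → ¬ v ∈ᵇ bag r′
      disjoint i≢j r r′ v∈ v∈′ with member r v∈ | member r′ v∈′
      ... | inj₁ (cv , _)   | inj₁ (cv′ , _)  = i≢j (Eq.trans (Eq.sym cv) cv′)
      ... | inj₁ (cv , own) | inj₂ (q , e)    = borrowed cv own q e
      ... | inj₂ (q , e)    | inj₁ (cv , own) = borrowed cv own q e
      ... | inj₂ (q , e)    | inj₂ (q′ , e′)  =
        i≢j (injective q q′ (m-injective (Eq.trans (Eq.sym e) e′)))

      top : ∀ {j} → Role j → Fin n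
      top     (hub _)    = h
      top {j} (solo _ _) = m j
      top {j} (near _)   = b j
      top {j} (far _ _)  = m j

      top-col : ∀ {j} (r : Role j) → col (top r) ≡ j
      top-col (hub j≡i₀) = Eq.trans h-col (Eq.sym j≡i₀)
      top-col (solo _ _) = m-col _
      top-col (near _)   = b-col _
      top-col (far _ _)  = m-col _

      viaTops : ∀ {i j} (r : Role i) (r′ : Role j) →
                Adj (top r) (top r′) → Edge (bag r) (bag r′)
      viaTops r r′ a = top r , top r′ , top∈ r , top∈ r′ , a
        where
        top∈ : ∀ {j} (r : Role j) → top r ∈ᵇ bag r
        top∈ (hub _)    = refl
        top∈ (solo _ _) = refl
        top∈ (near _)   = refl
        top∈ (far _ _)  = inj₁ refl

      h∼top : ∀ {j} → j ≢ i₀ → (r : Role j) → Adj h (top r)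
      h∼top j≢i₀ (hub j≡i₀) = ⊥-elim (j≢i₀ j≡i₀)
      h∼top j≢i₀ (solo _ _) = h-m _ j≢i₀
      h∼top _    (near p)   = P-h p
      h∼top j≢i₀ (far _ _)  = h-m _ j≢i₀

      solo∼top : ∀ {i j} → i ≢ j → b i ≡ m i → (r : Role j) → Adj (m i) (top r)
      solo∼top {i} i≢j alone r = alone-universal (m i) alone (top r)
        (λ e → i≢j (Eq.trans (Eq.sym (m-col i)) (Eq.trans (Eq.sym e) (top-col r))))

      edge : ∀ {i j} → i ≢ j → (r : Role i) (r′ : Role j) → Edge (bag r) (bag r′)
      edge i≢j r@(hub i≡i₀) r′ =
        viaTops r r′ (h∼top (λ j≡i₀ → i≢j (Eq.trans i≡i₀ (Eq.sym j≡i₀))) r′)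
      edge i≢j r@(solo _ b≡m) r′ = viaTops r r′ (solo∼top i≢j b≡m r′)
      edge i≢j r r′@(hub j≡i₀) =
        flipEdge (viaTops r′ r (h∼top (λ i≡i₀ → i≢j (Eq.trans i≡i₀ (Eq.sym j≡i₀))) r))
      edge i≢j r r′@(solo _ b≡m) =
        flipEdge (viaTops r′ r (solo∼top (λ e → i≢j (Eq.sym e)) b≡m r))
      edge i≢j r@(near p) r′@(near p′) = viaTops r r′ (P-clique p p′ i≢j)
      edge i≢j r@(near p) r′@(far q _) = viaTops r r′ (proj₁ (cross p q i≢j))
      edge i≢j r@(far q _) r′@(near p′) =
        flipEdge {bag r′} {bag r}
          (viaTops r′ r (proj₁ (cross p′ q (λ e → i≢j (Eq.sym e)))))
      edge {i} i≢j (far q ¬p) (far q′ _) =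
        m i , m (image q′) , inj₁ refl , inj₂ refl ,
        sym (proj₂ (cross (image∈P q′) q (image≢ q′ ¬p)))

      minor : ShallowCliqueMinor G k
      minor = cliqueMinor (λ j → bag (role j)) λ i j i≢j → record
        { disjoint = disjoint i≢j (role i) (role j)
        ; edge     = edge i≢j (role i) (role j)
        }

  module Separator (X : Subset n) (X<k : ∣ X ∣ < k) where

    Outside : Fin n → Set
    Outside v = v ∉ X

    Hit : Fin k → Set
    Hit i = ∃ λ v → col v ≡ i × v ∈ X

    hit? : ∀ i → Dec (Hit i)
    hit? i = FP.any? λ v → (col v ≟ i) ×-dec (v SP.∈? X)

    -- X is too small to meet all k classes.
    freeClass : ∃ λ i₀ → ∀ v → col v ≡ i₀ → v ∉ X
    freeClass with FP.all? hit?
    ... | yes hit = ⊥-elim (ℕP.<⇒≱ X<k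
                      (injection⇒≤∣∣ X (λ i → proj₁ (hit i)) hit-injective
                                        (λ i → proj₂ (proj₂ (hit i)))))
      where
      hit-injective : ∀ {i j} → proj₁ (hit i) ≡ proj₁ (hit j) → i ≡ j
      hit-injective = ≡⇒sameClass (proj₁ (proj₂ (hit _))) (proj₁ (proj₂ (hit _)))
    ... | no ¬allHit with FP.¬∀⟶∃¬ k Hit hit? ¬allHit
    ...   | i₀ , missed = i₀ , λ v cv v∈X → missed (v , cv , v∈X)

    i₀ : Fin k
    i₀ = proj₁ freeClass

    free : ∀ v → col v ≡ i₀ → v ∉ X
    free = proj₂ freeClass

    a a′ : Fin n
    a  = rep i₀
    a′ = partner a

    a-col : col a ≡ i₀
    a-col = rep-col i₀

    ShortPath : Fin n → Fin n → Set
    ShortPath x y = ∃₂ λ u w → u ∉ X × w ∉ X × Adj x u × Adj y w × (u ≡ w ⊎ Adj u w)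

    shortPath? : ∀ x y → Dec (ShortPath x y)
    shortPath? x y = FP.any? λ u → FP.any? λ w →
      ¬? (u SP.∈? X) ×-dec ¬? (w SP.∈? X) ×-dec adj? x u ×-dec adj? y w ×-dec
      ((u ≟ w) ⊎-dec adj? u w)

    shortPath⇒walk : ∀ {x y} → x ∉ X → y ∉ X → ShortPath x y → WalkIn G Outside x y
    shortPath⇒walk x∉ y∉ (u , .u , u∉ , _ , x∼u , y∼u , inj₁ refl) =
      step x∉ x∼u (step u∉ (sym y∼u) (here y∉))
    shortPath⇒walk x∉ y∉ (u , w , u∉ , w∉ , x∼u , y∼w , inj₂ u∼w) =
      step x∉ x∼u (step u∉ u∼w (step w∉ (sym y∼w) (here y∉)))

    -- Every vertex outside the free class has a neighbour in it, so it suffices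
    -- that the free class is connected to a within G - X.
    throughFreeClass : (∀ v → col v ≡ i₀ → WalkIn G Outside v a) → ConnectedSet G Outside
    throughFreeClass toHub = hub⇒connected a reach
      where
      reach : ∀ u → u ∉ X → WalkIn G Outside u a
      reach u u∉ with col u ≟ i₀
      ... | yes cu = toHub u cu
      ... | no cu≢i₀ with neighbourIn u i₀ cu≢i₀
      ...   | w , cw , u∼w = step u∉ u∼w (toHub w cw)

    -- The free class is {a, a′} and no short path joins a to a′: then X is
    -- exactly one vertex m j from every other class, and the minor appears.
    module Stuck (a′≢a : a′ ≢ a) (noPath : ¬ ShortPath a a′) where

      twins-a : Twins a a′
      twins-a = partner-twins a a′≢a

      a′-col : col a′ ≡ i₀
      a′-col = Eq.trans (partner-col a) a-col

      rep-col≢ : ∀ j → j ≢ i₀ → col (rep j) ≢ col a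
      rep-col≢ j j≢i₀ e = j≢i₀ (Eq.trans (Eq.sym (rep-col j)) (Eq.trans e a-col))

      m : Fin k → Fin n
      m j with j ≟ i₀
      ... | yes _    = a
      ... | no j≢i₀ = proj₁ (twins-commonNeighbour twins-a (rep j) (rep-col≢ j j≢i₀))

      m-spec : ∀ j → col (m j) ≡ j × (j ≢ i₀ → Adj a (m j) × Adj a′ (m j))
      m-spec j with j ≟ i₀
      ... | yes refl = a-col , λ i₀≢i₀ → ⊥-elim (i₀≢i₀ refl)
      ... | no j≢i₀ with twins-commonNeighbour twins-a (rep j) (rep-col≢ j j≢i₀)
      ...   | _ , cz , a∼z , a′∼z = Eq.trans cz (rep-col j) , λ _ → a∼z , a′∼z

      m-col : ∀ j → col (m j) ≡ j
      m-col j = proj₁ (m-spec j)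

      a∼m : ∀ j → j ≢ i₀ → Adj a (m j)
      a∼m j j≢i₀ = proj₁ (proj₂ (m-spec j) j≢i₀)

      a′∼m : ∀ j → j ≢ i₀ → Adj a′ (m j)
      a′∼m j j≢i₀ = proj₂ (proj₂ (m-spec j) j≢i₀)

      open Skeleton i₀ m m-col

      -- m j lies in X, or a – m j – a′ would be a short path
      m∈X : ∀ j → j ≢ i₀ → m j ∈ X
      m∈X j j≢i₀ with m j SP.∈? X
      ... | yes m∈ = m∈
      ... | no m∉  =
        ⊥-elim (noPath (m j , m j , m∉ , m∉ , a∼m j j≢i₀ , a′∼m j j≢i₀ , inj₁ refl))

      -- X holds no vertex besides the k - 1 vertices m j, j ≢ i₀
      others∉X : ∀ v → col v ≢ i₀ → v ≢ m (col v) → v ∉ X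
      others∉X v cv≢i₀ v≢m v∈X =
        ℕP.<⇒≱ X<k
          (injection⇒≤∣∣ X (λ j → f j (j ≟ i₀)) f-injective (λ j → f∈X j (j ≟ i₀)))
        where
        -- the vertices m j, with v in place of m i₀
        f : ∀ j → Dec (j ≡ i₀) → Fin n
        f j (yes _) = v
        f j (no _)  = m j

        f∈X : ∀ j d → f j d ∈ X
        f∈X j (yes _)    = v∈X
        f∈X j (no j≢i₀) = m∈X j j≢i₀

        v≢m′ : ∀ j → v ≢ m j
        v≢m′ j e = v≢m (Eq.trans e (cong m (Eq.sym (Eq.trans (cong col e) (m-col j)))))

        f-injective : ∀ {i j} → f i (i ≟ i₀) ≡ f j (j ≟ i₀) → i ≡ j
        f-injective {i} {j} with i ≟ i₀ | j ≟ i₀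
        ... | yes i≡i₀ | yes j≡i₀ = λ _ → Eq.trans i≡i₀ (Eq.sym j≡i₀)
        ... | yes _    | no _     = λ e → ⊥-elim (v≢m′ j e)
        ... | no _     | yes _    = λ e → ⊥-elim (v≢m′ i (Eq.sym e))
        ... | no _     | no _     = m-injective

      b∉X : ∀ {j} → Twin j → b j ∉ X
      b∉X {j} (j≢i₀ , b≢m) = others∉X (b j) (λ e → j≢i₀ (Eq.trans (Eq.sym (b-col j)) e))
                                      (λ e → b≢m (Eq.trans e (cong m (b-col j))))

      -- b j is adjacent to at most one of a, a′ (else a – b j – a′) ...
      notBoth : ∀ {j} → Twin j → Adj a (b j) → ¬ Adj a′ (b j)
      notBoth t a∼b a′∼b = noPath (_ , _ , b∉X t , b∉X t , a∼b , a′∼b , inj₁ refl)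

      -- ... and to at least one, as a ≁ a′ and there is no antitriangle.
      a≁b⇒a′∼b : ∀ {j} → Twin j → ¬ Adj a (b j) → Adj a′ (b j)
      a≁b⇒a′∼b {j} (j≢i₀ , _) a≁b =
        commonNonNeighbour (λ e → differentClass⇒≢ (b-col j) a′-col j≢i₀ (Eq.sym e)) a′≢a
                           (differentClass⇒≢ (b-col j) a-col j≢i₀)
                           (λ a′∼a → anticlique a a′ (proj₁ twins-a) (sym a′∼a))
                           (λ b∼a → a≁b (sym b∼a))

      -- b-vertices on opposite sides are non-adjacent (else a – b i – b j – a′) ...
      apart : ∀ {i j} → Twin i → Twin j → Adj a (b i) → Adj a′ (b j) → ¬ Adj (b i) (b j)
      apart ti tj a∼bi a′∼bj bi∼bj =
        noPath (_ , _ , b∉X ti , b∉X tj , a∼bi , a′∼bj , inj₂ bi∼bj)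

      sameSide : ∀ {c i l} → col c ≡ i₀ → Twin i → Twin l → i ≢ l →
                 ¬ Adj c (b i) → ¬ Adj c (b l) → Adj (b i) (b l)
      sameSide {c} {i} {l} cc ti tl i≢l c≁bi c≁bl =
        commonNonNeighbour (differentClass⇒≢ (b-col i) (b-col l) i≢l) (b≢c ti) (b≢c tl)
                           (λ bi∼c → c≁bi (sym bi∼c)) (λ bl∼c → c≁bl (sym bl∼c))
        where
        b≢c : ∀ {j} → Twin j → b j ≢ c
        b≢c {j} (j≢i₀ , _) = differentClass⇒≢ (b-col j) cc j≢i₀

      Near Far : Fin k → Set
      Near j = Twin j × Adj a (b j)
      Far  j = Twin j × ¬ Adj a (b j)

      near? : ∀ j → Dec (Near j)
      near? j = twin? j ×-dec adj? a (b j)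

      far? : ∀ j → Dec (Far j)
      far? j = twin? j ×-dec ¬? (adj? a (b j))

      minorAt-a : Embedding Far Near → ShallowCliqueMinor G k
      minorAt-a = HubMinor.minor a a-col a∼m near? proj₁ proj₂ proj₁
        (λ t ¬near → t , λ a∼b → ¬near (t , a∼b))
        (λ (ti , a∼bi) (tl , a∼bl) i≢l →
           sameSide a′-col ti tl i≢l (notBoth ti a∼bi) (notBoth tl a∼bl))
        (λ (ti , a∼bi) (tj , a≁bj) → apart ti tj a∼bi (a≁b⇒a′∼b tj a≁bj))

      minorAt-a′ : Embedding Near Far → ShallowCliqueMinor G k
      minorAt-a′ = HubMinor.minor a′ a′-col a′∼m far?
        proj₁ (λ (t , a≁b) → a≁b⇒a′∼b t a≁b) proj₁
        (λ {j} t ¬far → t , decidable-stable (adj? a (b j)) (λ a≁b → ¬far (t , a≁b)))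
        (λ (ti , a≁bi) (tl , a≁bl) i≢l → sameSide a-col ti tl i≢l a≁bi a≁bl)
        (λ (ti , a≁bi) (tj , a∼bj) bi∼bj →
           apart tj ti a∼bj (a≁b⇒a′∼b ti a≁bi) (sym bi∼bj))

      minor : ShallowCliqueMinor G k
      minor with ℕP.≤-total (count far?) (count near?)
      ... | inj₁ far≤near = minorAt-a (embedding near? far? far≤near)
      ... | inj₂ near≤far = minorAt-a′ (embedding far? near? near≤far)

    separate : ConnectedSet G Outside ⊎ ShallowCliqueMinor G k
    separate with partner a ≟ a
    ... | yes alone = inj₁ (throughFreeClass λ v cv →
          subst (λ x → WalkIn G Outside x a)
                (Eq.sym (partner-alone a alone v (Eq.trans cv (Eq.sym a-col))))
                (here (free a a-col)))
    ... | no a′≢a with shortPath? a a′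
    ...   | no noPath = inj₂ (Stuck.minor a′≢a noPath)
    ...   | yes path = inj₁ (throughFreeClass toHub)
      where
      toHub : ∀ v → col v ≡ i₀ → WalkIn G Outside v a
      toHub v cv with twins-cover (partner-twins a a′≢a) (Eq.trans cv (Eq.sym a-col))
      ... | inj₁ refl = here (free a a-col)
      ... | inj₂ refl = reverseʷ (shortPath⇒walk (free a a-col)
                                   (free a′ (Eq.trans (partner-col a) a-col)) path)

  separated : ∀ X → (∣ X ∣ < k → ConnectedSet G (λ v → v ∉ X)) ⊎ ShallowCliqueMinor G k
  separated X with ∣ X ∣ ℕ.<? k
  ... | no X≮k = inj₁ (λ X<k → ⊥-elim (X≮k X<k))
  ... | yes X<k with Separator.separate X X<k
  ...   | inj₁ connected = inj₁ (λ _ → connected)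
  ...   | inj₂ minor     = inj₂ minor

  theorem : KConnected G k ⊎ ShallowCliqueMinor G k
  theorem with k ℕ.<? n
  ... | no k≮n = inj₂ (singletonMinor (allAlone k≮n))
  ... | yes k<n with allSubsets-or separated
  ...   | inj₁ connected = inj₁ (k<n , connected)
  ...   | inj₂ minor     = inj₂ minor

lemma2 : (n : ℕ) (G : Graph n) (k : ℕ) → NoAntitriangle G →
    Σ (Coloring G k) (IsKempe G) →
    KConnected G k ⊎ ShallowCliqueMinor G k
lemma2 n G k noAntitriangle (C , kempe) = KempeColoring.theorem G noAntitriangle C kempe
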